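{- Let $\langle A,B\rangle$ be an $(m,n)$-feasible pair of integer sequences, $A=\langle a_1,\ldots,a_m\rangle$, $B=\langle b_1,\ldots,b_n\rangle$, and let $\bar A=\langle n-a_1,\ldots,n-a_m\rangle$ and $\bar B=\langle m-b_1,\ldots,m-b_n\rangle$. Then ($\bar A_B$ is defined and equals $\mathbf{0}$) if and only if ($\bar B_A$ is defined and equals $\mathbf{0}$).
   Context: An $(m,n)$-sequence is a sequence of $m$ real numbers each in $[0,n]$. A pair $\langle A,B\rangle$ with $A$ an $(m,n)$-sequence and $B$ an $(n,m)$-sequence is an $(m,n)$-feasible pair if the sum of all entries of $A$ plus the sum of all entries of $B$ equals $mn$. For an integer sequence $S$ and an integer $c\ge 0$ at most the number of positive entries of $S$, a normal $c$-trimming $S_{\langle c\rangle}$ is obtained by subtracting $1$ from $c$ largest positive entries of $S$ (for $c=0$, $S_{\langle 0\rangle}=S$). For $C=\langle c_1,\ldots,c_k\rangle$, $S_C$ denotes applying to $S$ a normal $c_1$-trimming, then a normal $c_2$-trimming to the result, and so on up to a normal $c_k$-trimming; $S_C$ is defined if each step is possible, i.e. at each step $c_i$ does not exceed the number of positive entries of the current sequence. $\mathbf{0}$ denotes a sequence all of whose entries are zero. -}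

module Defs where

open import Data.Nat using (ℕ; zero; suc; _+_; _∸_; _≤_; _<_)
open import Data.Fin using (Fin)
open import Data.Vec using (Vec; []; _∷_; map; lookup; replicate; toList)
open import Data.Vec.Relation.Unary.All using (All)
open import Data.Bool using (Bool; true; false; if_then_else_)
open import Data.Product using (Σ; _×_; ∃)
open import Relation.Binary.PropositionalEquality using (_≡_)

IsSeq : (m n : ℕ) → Vec ℕ m → Set
IsSeq m n S = All (λ x → x ≤ n) S

vsum : ∀ {m} → Vec ℕ m → ℕ
vsum [] = 0
vsum (x ∷ S) = x + vsum S

count : ∀ {m} → Vec Bool m → ℕ
count [] = 0
count (true ∷ I) = suc (count I)
count (false ∷ I) = count I

decAt : ∀ {m} → Vec Bool m → Vec ℕ m → Vec ℕ m
decAt [] [] = []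
decAt (b ∷ I) (x ∷ S) = (if b then x ∸ 1 else x) ∷ decAt I S

LargestPositive : ∀ {m} → ℕ → Vec ℕ m → Vec Bool m → Set
LargestPositive {m} c S I =
  (count I ≡ c)
  × (∀ (i : Fin m) → lookup I i ≡ true → 0 < lookup S i)
  × (∀ (i j : Fin m) → lookup I i ≡ true → lookup I j ≡ false →
       lookup S j ≤ lookup S i)

NormalTrim : ∀ {m} → ℕ → Vec ℕ m → Vec ℕ m → Set
NormalTrim {m} c S T = Σ (Vec Bool m) λ I → LargestPositive c S I × (T ≡ decAt I S)

-- TrimSeq C S T : T is a result of S_C (successive normal trimmings
-- by c₁, …, c_k, each step possible).
data TrimSeq {m : ℕ} : ∀ {k} → Vec ℕ k → Vec ℕ m → Vec ℕ m → Set where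
  done : ∀ {S} → TrimSeq [] S S
  step : ∀ {k c} {C : Vec ℕ k} {S S′ T} →
         NormalTrim c S S′ → TrimSeq C S′ T → TrimSeq (c ∷ C) S T

TrimsToZero : ∀ {m k} → Vec ℕ m → Vec ℕ k → Set
TrimsToZero {m} S C = TrimSeq C S (replicate m 0)

compl : ∀ {m} → ℕ → Vec ℕ m → Vec ℕ m
compl n A = map (λ a → n ∸ a) A

Feasible : (m n : ℕ) → Vec ℕ m → Vec ℕ n → Set
Feasible m n A B = IsSeq m n A × IsSeq n m B × (vsum A + vsum B ≡ m Data.Nat.* n)

-- Record the successive normal trimmings of S by C as a 0-1 matrix whose t-th column is the
-- set of entries decremented at step t: then S_C = 0 says exactly that this matrix has row
-- sums S and column sums C. Conversely, every such matrix can be turned into one whose first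
-- column selects largest entries by Ryser interchanges (swapping a 2x2 checkerboard, which
-- keeps all row and column sums), so S_C = 0 iff some 0-1 matrix has row sums S and column
-- sums C. Complementing and transposing a matrix with row sums n - A and column sums B gives
-- one with row sums m - B and column sums A, which is the symmetry of the theorem.
module Submission where

open import Data.Bool using (Bool; true; false; not; if_then_else_)
import Data.Bool.Properties as Bool
open import Data.Empty using (⊥-elim)
open import Data.Fin using (Fin; zero; suc) renaming (_≟_ to _≟ᶠ_)
open import Data.Fin.Properties using (any?)
open import Data.Nat using (ℕ; zero; suc; _+_; _∸_; _≤_; _<_; z≤n; s≤s; _≤?_; _<?_)
open import Data.Nat.Properties
open import Algebra.Properties.CommutativeSemigroup +-commutativeSemigroup
  using (xy∙z≈zy∙x; x∙yz≈xz∙y; xy∙z≈xz∙y)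
open import Data.Product using (Σ; ∃; _×_; _,_)
import Data.Product as Product
open import Data.Vec using (Vec; []; _∷_; head; lookup; map; replicate; tabulate; _[_]≔_)
open import Data.Vec.Properties
  using (∷-injectiveˡ; ∷-injectiveʳ; lookup-map; lookup-replicate; lookup∘tabulate;
         tabulate-cong; lookup∘update; lookup∘update′; map-[]≔; []≔-lookup)
open import Data.Vec.Relation.Binary.Pointwise.Extensional using (ext; Pointwise-≡⇒≡)
open import Data.Vec.Relation.Unary.All using ([]; _∷_)
open import Function using (_∘_; id)
open import Function.Bundles using (_⇔_; mk⇔)
open import Relation.Binary.PropositionalEquality
open import Relation.Nullary using (¬_; Dec; yes; no; contradiction)
open import Relation.Nullary.Decidable using (_×-dec_)
open import Defs

private
  variable
    A : Set
    m k : ℕ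

mask : Bool → ℕ → ℕ
mask b x = if b then x else 0

toℕ : Bool → ℕ
toℕ b = mask b 1

weight : Vec Bool m → Vec ℕ m → ℕ
weight []      []      = 0
weight (b ∷ v) (x ∷ S) = mask b x + weight v S

weight≤vsum : ∀ (v : Vec Bool m) S → weight v S ≤ vsum S
weight≤vsum []          []      = z≤n
weight≤vsum (true  ∷ v) (x ∷ S) = +-monoʳ-≤ x (weight≤vsum v S)
weight≤vsum (false ∷ v) (x ∷ S) = ≤-trans (weight≤vsum v S) (m≤n+m _ x)

count≡weight-ones : ∀ (v : Vec Bool m) → count v ≡ weight v (replicate m 1)
count≡weight-ones []          = refl
count≡weight-ones (true  ∷ v) = cong suc (count≡weight-ones v)
count≡weight-ones (false ∷ v) = count≡weight-ones v

count-∷ : ∀ b (v : Vec Bool m) → count (b ∷ v) ≡ toℕ b + count v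
count-∷ true  v = refl
count-∷ false v = refl

weight-[]≔ : ∀ (v : Vec Bool m) S a y →
  weight (v [ a ]≔ y) S + mask (lookup v a) (lookup S a) ≡ weight v S + mask y (lookup S a)
weight-[]≔ (b ∷ v) (x ∷ S) zero    y = xy∙z≈zy∙x (mask y x) (weight v S) (mask b x)
weight-[]≔ (b ∷ v) (x ∷ S) (suc a) y = begin
  mask b x + weight (v [ a ]≔ y) S + mask (lookup v a) (lookup S a)
    ≡⟨ +-assoc (mask b x) _ _ ⟩
  mask b x + (weight (v [ a ]≔ y) S + mask (lookup v a) (lookup S a))
    ≡⟨ cong (mask b x +_) (weight-[]≔ v S a y) ⟩
  mask b x + (weight v S + mask y (lookup S a))
    ≡⟨ +-assoc (mask b x) _ _ ⟨
  mask b x + weight v S + mask y (lookup S a) ∎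
  where open ≡-Reasoning

swap : ∀ {n} → Fin n → Fin n → Vec A n → Vec A n
swap a b v = (v [ a ]≔ lookup v b) [ b ]≔ lookup v a

lookup-[]≔-lookup : ∀ {n} (v : Vec A n) a b → lookup (v [ a ]≔ lookup v b) b ≡ lookup v b
lookup-[]≔-lookup v a b with a ≟ᶠ b
... | yes refl = lookup∘update a v _
... | no a≢b   = lookup∘update′ (a≢b ∘ sym) v _

lookup-swapˡ : ∀ {n} (v : Vec A n) a b → lookup (swap a b v) a ≡ lookup v b
lookup-swapˡ v a b with a ≟ᶠ b
... | yes refl = lookup∘update a (v [ a ]≔ lookup v a) (lookup v a)
... | no a≢b   = trans (lookup∘update′ a≢b (v [ a ]≔ lookup v b) (lookup v a)) (lookup∘update a v (lookup v b))

lookup-swapʳ : ∀ {n} (v : Vec A n) a b → lookup (swap a b v) b ≡ lookup v a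
lookup-swapʳ v a b = lookup∘update b (v [ a ]≔ lookup v b) (lookup v a)

lookup-swap : ∀ {n} (v : Vec A n) {a b p} → p ≢ a → p ≢ b → lookup (swap a b v) p ≡ lookup v p
lookup-swap v {a} {b} p≢a p≢b =
  trans (lookup∘update′ p≢b (v [ a ]≔ lookup v b) (lookup v a)) (lookup∘update′ p≢a v (lookup v b))

weight-swap : ∀ (v : Vec Bool m) S a b →
  weight (swap a b v) S + (mask (lookup v a) (lookup S a) + mask (lookup v b) (lookup S b))
  ≡ weight v S + (mask (lookup v b) (lookup S a) + mask (lookup v a) (lookup S b))
weight-swap v S a b = begin
  w₂ + (x + y)   ≡⟨ x∙yz≈xz∙y w₂ x y ⟩
  w₂ + y + x     ≡⟨ cong (_+ x) step₂ ⟩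
  w₁ + y′ + x    ≡⟨ xy∙z≈xz∙y w₁ y′ x ⟩
  w₁ + x + y′    ≡⟨ cong (_+ y′) (weight-[]≔ v S a (lookup v b)) ⟩
  w + x′ + y′    ≡⟨ +-assoc w x′ y′ ⟩
  w + (x′ + y′)  ∎
  where
  open ≡-Reasoning
  v₁ = v [ a ]≔ lookup v b
  w = weight v S
  w₁ = weight v₁ S
  w₂ = weight (swap a b v) S
  x = mask (lookup v a) (lookup S a)
  y = mask (lookup v b) (lookup S b)
  x′ = mask (lookup v b) (lookup S a)
  y′ = mask (lookup v a) (lookup S b)
  step₂ : w₂ + y ≡ w₁ + y′
  step₂ = trans (cong (λ c → w₂ + mask c (lookup S b)) (sym (lookup-[]≔-lookup v a b)))
                (weight-[]≔ v₁ S b (lookup v a))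

count-swap : ∀ (v : Vec Bool m) a b → count (swap a b v) ≡ count v
count-swap {m} v a b = +-cancelʳ-≡ (x + y) _ _ (begin
  count (swap a b v) + (x + y)          ≡⟨ cong (_+ (x + y)) (count≡weight-ones (swap a b v)) ⟩
  weight (swap a b v) ones + (x + y)    ≡⟨ weight-swap v ones a b ⟩
  weight v ones + (x′ + y′)             ≡⟨ cong₂ _+_ (sym (count≡weight-ones v)) balanced ⟩
  count v + (x + y)                     ∎)
  where
  open ≡-Reasoning
  ones = replicate m 1
  x = mask (lookup v a) (lookup ones a)
  y = mask (lookup v b) (lookup ones b)
  x′ = mask (lookup v b) (lookup ones a)
  y′ = mask (lookup v a) (lookup ones b)
  balanced : x′ + y′ ≡ x + y
  balanced = trans (+-comm x′ y′)
    (cong₂ (λ s t → mask (lookup v a) s + mask (lookup v b) t)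
           (trans (lookup-replicate b 1) (sym (lookup-replicate a 1)))
           (trans (lookup-replicate a 1) (sym (lookup-replicate b 1))))

weight-swap-increases : ∀ (J : Vec Bool m) S {i j} →
  lookup J i ≡ true → lookup J j ≡ false → lookup S i < lookup S j →
  weight J S < weight (swap i j J) S
weight-swap-increases J S {i} {j} Jᵢ Jⱼ Sᵢ<Sⱼ = +-cancelʳ-< (lookup S i) _ _ (begin-strict
  weight J S + lookup S i
    <⟨ +-monoʳ-< (weight J S) Sᵢ<Sⱼ ⟩
  weight J S + lookup S j
    ≡⟨ cong (weight J S +_) (cong₂ (λ c d → mask d (lookup S i) + mask c (lookup S j)) Jᵢ Jⱼ) ⟨
  weight J S + (mask (lookup J j) (lookup S i) + mask (lookup J i) (lookup S j))
    ≡⟨ weight-swap J S i j ⟨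
  weight (swap i j J) S + (mask (lookup J i) (lookup S i) + mask (lookup J j) (lookup S j))
    ≡⟨ cong (weight (swap i j J) S +_) (cong₂ (λ c d → mask c (lookup S i) + mask d (lookup S j)) Jᵢ Jⱼ) ⟩
  weight (swap i j J) S + (lookup S i + 0)
    ≡⟨ cong (weight (swap i j J) S +_) (+-identityʳ (lookup S i)) ⟩
  weight (swap i j J) S + lookup S i ∎)
  where open ≤-Reasoning

count<⇒false-true : ∀ (u v : Vec Bool k) → count u < count v →
  ∃ λ t → lookup u t ≡ false × lookup v t ≡ true
count<⇒false-true []          []          ()
count<⇒false-true (false ∷ u) (true  ∷ v) _        = zero , refl , refl
count<⇒false-true (true  ∷ u) (true  ∷ v) (s≤s lt) = Product.map suc id (count<⇒false-true u v lt)
count<⇒false-true (true  ∷ u) (false ∷ v) lt       = Product.map suc id (count<⇒false-true u v (<-trans (n<1+n _) lt))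
count<⇒false-true (false ∷ u) (false ∷ v) lt       = Product.map suc id (count<⇒false-true u v lt)

lookup-decAt : ∀ (I : Vec Bool m) S p → lookup (decAt I S) p ≡ lookup S p ∸ toℕ (lookup I p)
lookup-decAt (true  ∷ I) (x ∷ S) zero    = refl
lookup-decAt (false ∷ I) (x ∷ S) zero    = refl
lookup-decAt (b     ∷ I) (x ∷ S) (suc p) = lookup-decAt I S p

toℕ≤ : ∀ b {x} → (b ≡ true → 0 < x) → toℕ b ≤ x
toℕ≤ true  positive = positive refl
toℕ≤ false _        = z≤n

decAt-split : ∀ (I : Vec Bool m) S → (∀ i → lookup I i ≡ true → 0 < lookup S i) →
  ∀ p → lookup S p ≡ toℕ (lookup I p) + lookup (decAt I S) p
decAt-split I S positive p = sym (begin
  toℕ (lookup I p) + lookup (decAt I S) p          ≡⟨ cong (toℕ (lookup I p) +_) (lookup-decAt I S p) ⟩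
  toℕ (lookup I p) + (lookup S p ∸ toℕ (lookup I p)) ≡⟨ m+[n∸m]≡n (toℕ≤ (lookup I p) (positive p)) ⟩
  lookup S p                                        ∎)
  where open ≡-Reasoning

-- A matrix is stored as the vector of its columns.
Matrix : ℕ → ℕ → Set
Matrix m k = Vec (Vec Bool m) k

row : Fin m → Matrix m k → Vec Bool k
row p M = map (λ column → lookup column p) M

rowSums : Matrix m k → Vec ℕ m
rowSums M = tabulate λ p → count (row p M)

colSums : Matrix m k → Vec ℕ k
colSums M = map count M

Realises : Matrix m k → Vec ℕ m → Vec ℕ k → Set
Realises M R C = rowSums M ≡ R × colSums M ≡ C

lookup-rowSums-∷ : ∀ c (M : Matrix m k) p →
  lookup (rowSums (c ∷ M)) p ≡ toℕ (lookup c p) + count (row p M)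
lookup-rowSums-∷ c M p = trans (lookup∘tabulate _ p) (count-∷ (lookup c p) (row p M))

rowSums-[] : rowSums {m} [] ≡ replicate m 0
rowSums-[] = Pointwise-≡⇒≡ (ext λ p → trans (lookup∘tabulate _ p) (sym (lookup-replicate p 0)))

row-[]≔ : ∀ (M : Matrix m k) a c p → row p (M [ a ]≔ c) ≡ row p M [ a ]≔ lookup c p
row-[]≔ M a c p = map-[]≔ (λ column → lookup column p) M a

[]≔-lookup₂ : ∀ {n} (v : Vec A n) a b → (v [ a ]≔ lookup v a) [ b ]≔ lookup v b ≡ v
[]≔-lookup₂ v a b = trans (cong (λ w → w [ b ]≔ lookup v b) ([]≔-lookup v a)) ([]≔-lookup v b)

switch : Fin k → Fin k → Fin m → Fin m → Matrix m k → Matrix m k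
switch a b i j M = (M [ a ]≔ swap i j (lookup M a)) [ b ]≔ swap i j (lookup M b)

module _ (M : Matrix m k) (a b : Fin k) (i j : Fin m)
         (eᵢ : lookup (lookup M a) i ≡ lookup (lookup M b) j)
         (eⱼ : lookup (lookup M a) j ≡ lookup (lookup M b) i) where

  private
    entry : ∀ p c → lookup (row p M) c ≡ lookup (lookup M c) p
    entry p c = lookup-map c (λ column → lookup column p) M

    row-switch : ∀ p → row p (switch a b i j M)
      ≡ (row p M [ a ]≔ lookup (swap i j (lookup M a)) p) [ b ]≔ lookup (swap i j (lookup M b)) p
    row-switch p = trans (row-[]≔ (M [ a ]≔ swap i j (lookup M a)) b _ p)
                         (cong (_[ b ]≔ _) (row-[]≔ M a _ p))

    count-row-switch : ∀ p → count (row p (switch a b i j M)) ≡ count (row p M)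
    count-row-switch p with p ≟ᶠ i | p ≟ᶠ j
    ... | yes refl | _ = trans (cong count (trans (row-switch p) (cong₂ (λ x y → (r [ a ]≔ x) [ b ]≔ y)
            (trans (lookup-swapˡ (lookup M a) i j) (trans eⱼ (sym (entry i b))))
            (trans (lookup-swapˡ (lookup M b) i j) (trans (sym eᵢ) (sym (entry i a)))))))
          (count-swap r a b)
      where r = row p M
    ... | no _ | yes refl = trans (cong count (trans (row-switch p) (cong₂ (λ x y → (r [ a ]≔ x) [ b ]≔ y)
            (trans (lookup-swapʳ (lookup M a) i j) (trans eᵢ (sym (entry j b))))
            (trans (lookup-swapʳ (lookup M b) i j) (trans (sym eⱼ) (sym (entry j a)))))))
          (count-swap r a b)
      where r = row p M
    ... | no p≢i | no p≢j = cong count (trans (row-switch p) (trans (cong₂ (λ x y → (r [ a ]≔ x) [ b ]≔ y)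
            (trans (lookup-swap (lookup M a) p≢i p≢j) (sym (entry p a)))
            (trans (lookup-swap (lookup M b) p≢i p≢j) (sym (entry p b))))
          ([]≔-lookup₂ r a b)))
      where r = row p M

  rowSums-switch : rowSums (switch a b i j M) ≡ rowSums M
  rowSums-switch = tabulate-cong count-row-switch

  colSums-switch : colSums (switch a b i j M) ≡ colSums M
  colSums-switch = begin
    map count ((M [ a ]≔ swap i j (lookup M a)) [ b ]≔ swap i j (lookup M b))
      ≡⟨ trans (map-[]≔ count _ b) (cong (_[ b ]≔ _) (map-[]≔ count M a)) ⟩
    (colSums M [ a ]≔ count (swap i j (lookup M a))) [ b ]≔ count (swap i j (lookup M b))
      ≡⟨ cong₂ (λ x y → (colSums M [ a ]≔ x) [ b ]≔ y)
               (trans (count-swap (lookup M a) i j) (sym (lookup-map a count M)))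
               (trans (count-swap (lookup M b) i j) (sym (lookup-map b count M))) ⟩
    (colSums M [ a ]≔ lookup (colSums M) a) [ b ]≔ lookup (colSums M) b
      ≡⟨ []≔-lookup₂ (colSums M) a b ⟩
    colSums M ∎
    where open ≡-Reasoning

SelectsLargest : Vec ℕ m → Vec Bool m → Set
SelectsLargest {m} S J = ∀ (i j : Fin m) →
  lookup J i ≡ true → lookup J j ≡ false → lookup S j ≤ lookup S i

Inversion : Vec ℕ m → Vec Bool m → Set
Inversion S J = ∃ λ i → ∃ λ j →
  lookup J i ≡ true × lookup J j ≡ false × lookup S i < lookup S j

inversion? : ∀ (S : Vec ℕ m) J → Dec (Inversion S J)
inversion? S J = any? λ i → any? λ j →
  (lookup J i Bool.≟ true) ×-dec (lookup J j Bool.≟ false) ×-dec (lookup S i <? lookup S j)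

¬inversion⇒selectsLargest : ∀ {S : Vec ℕ m} {J} → ¬ Inversion S J → SelectsLargest S J
¬inversion⇒selectsLargest {S = S} ¬inv i j Jᵢ Jⱼ with lookup S j ≤? lookup S i
... | yes Sⱼ≤Sᵢ = Sⱼ≤Sᵢ
... | no  Sⱼ≰Sᵢ = contradiction (i , j , Jᵢ , Jⱼ , ≰⇒> Sⱼ≰Sᵢ) ¬inv

-- An inversion of the first column J (i selected, j not, yet S i < S j) leaves row j with
-- more ones than row i outside J, so some other column has 0 in row i and 1 in row j.
exchange : ∀ {S C} (N : Matrix m (suc k)) → Realises N S C → Inversion S (head N) →
  Σ (Matrix m (suc k)) λ N′ → Realises N′ S C × weight (head N) S < weight (head N′) S
exchange {S = S} (J ∷ M) (rs , cs) (i , j , Jᵢ , Jⱼ , Sᵢ<Sⱼ)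
  with count<⇒false-true (row i M) (row j M) rowᵢ<rowⱼ
  where
  rowSum : ∀ p → lookup S p ≡ toℕ (lookup J p) + count (row p M)
  rowSum p = trans (cong (λ R → lookup R p) (sym rs)) (lookup-rowSums-∷ J M p)
  rowᵢ<rowⱼ : count (row i M) < count (row j M)
  rowᵢ<rowⱼ = <-trans (n<1+n _) (subst₂ _<_
    (trans (rowSum i) (cong (λ c → toℕ c + _) Jᵢ)) (trans (rowSum j) (cong (λ c → toℕ c + _) Jⱼ)) Sᵢ<Sⱼ)
... | t , Mₜᵢ , Mₜⱼ =
  switch zero (suc t) i j (J ∷ M) ,
  (trans (rowSums-switch (J ∷ M) zero (suc t) i j eᵢ eⱼ) rs ,
   trans (colSums-switch (J ∷ M) zero (suc t) i j eᵢ eⱼ) cs) ,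
  weight-swap-increases J S Jᵢ Jⱼ Sᵢ<Sⱼ
  where
  eᵢ : lookup J i ≡ lookup (lookup M t) j
  eᵢ = trans Jᵢ (sym (trans (sym (lookup-map t (λ column → lookup column j) M)) Mₜⱼ))
  eⱼ : lookup J j ≡ lookup (lookup M t) i
  eⱼ = trans Jⱼ (sym (trans (sym (lookup-map t (λ column → lookup column i) M)) Mₜᵢ))

-- Each exchange increases the weight of the first column, which is bounded by vsum S.
normalise : ∀ {S C} (fuel : ℕ) (N : Matrix m (suc k)) → Realises N S C →
  vsum S ≤ weight (head N) S + fuel →
  Σ (Matrix m (suc k)) λ N′ → Realises N′ S C × SelectsLargest S (head N′)
normalise {S = S} fuel N r bound with inversion? S (head N)
... | no ¬inv = N , r , ¬inversion⇒selectsLargest {S = S} {J = head N} ¬inv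
... | yes inv with exchange N r inv
normalise {S = S} zero N r bound | yes _ | N′ , _ , increases =
  ⊥-elim (<⇒≱ (≤-<-trans (subst (vsum S ≤_) (+-identityʳ _) bound) increases) (weight≤vsum (head N′) S))
normalise {S = S} (suc fuel) N r bound | yes _ | N′ , r′ , increases =
  normalise fuel N′ r′ (≤-trans bound
    (subst (_≤ weight (head N′) S + fuel) (sym (+-suc (weight (head N) S) fuel)) (+-monoˡ-≤ fuel increases)))

realises⇒trimsToZero : ∀ (M : Matrix m k) {S C} → Realises M S C → TrimsToZero S C
realises⇒trimsToZero [] (refl , refl) = subst (TrimSeq [] (rowSums [])) rowSums-[] done
realises⇒trimsToZero (I ∷ M) {S} {c ∷ C} r
  with normalise (vsum S) (I ∷ M) r (m≤n+m (vsum S) _)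
... | J ∷ M′ , (rs , cs) , largest =
  step (J , (∷-injectiveˡ cs , positive , largest) , refl)
       (realises⇒trimsToZero M′ (rowSums-decAt , ∷-injectiveʳ cs))
  where
  rowSum : ∀ p → lookup S p ≡ toℕ (lookup J p) + count (row p M′)
  rowSum p = trans (cong (λ R → lookup R p) (sym rs)) (lookup-rowSums-∷ J M′ p)
  positive : ∀ i → lookup J i ≡ true → 0 < lookup S i
  positive i Jᵢ = subst (0 <_) (sym (trans (rowSum i) (cong (λ b → toℕ b + _) Jᵢ))) (s≤s z≤n)
  rowSums-decAt : rowSums M′ ≡ decAt J S
  rowSums-decAt = Pointwise-≡⇒≡ (ext λ p → begin
    lookup (rowSums M′) p                              ≡⟨ lookup∘tabulate _ p ⟩
    count (row p M′)                                   ≡⟨ m+n∸m≡n (toℕ (lookup J p)) _ ⟨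
    toℕ (lookup J p) + count (row p M′) ∸ toℕ (lookup J p) ≡⟨ cong (_∸ toℕ (lookup J p)) (rowSum p) ⟨
    lookup S p ∸ toℕ (lookup J p)                      ≡⟨ lookup-decAt J S p ⟨
    lookup (decAt J S) p                               ∎)
    where open ≡-Reasoning

trimSeq⇒matrix : ∀ {C : Vec ℕ k} {S T : Vec ℕ m} → TrimSeq C S T →
  Σ (Matrix m k) λ M → colSums M ≡ C × (∀ p → lookup S p ≡ count (row p M) + lookup T p)
trimSeq⇒matrix done = [] , refl , λ p → refl
trimSeq⇒matrix {S = S} {T} (step (I , (countI , positive , _) , refl) rest) with trimSeq⇒matrix rest
... | M , cs , split = I ∷ M , cong₂ _∷_ countI cs , λ p → begin
  lookup S p                                          ≡⟨ decAt-split I S positive p ⟩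
  toℕ (lookup I p) + lookup (decAt I S) p             ≡⟨ cong (toℕ (lookup I p) +_) (split p) ⟩
  toℕ (lookup I p) + (count (row p M) + lookup T p)   ≡⟨ +-assoc (toℕ (lookup I p)) _ _ ⟨
  toℕ (lookup I p) + count (row p M) + lookup T p     ≡⟨ cong (_+ lookup T p) (count-∷ (lookup I p) (row p M)) ⟨
  count (row p (I ∷ M)) + lookup T p                  ∎
  where open ≡-Reasoning

trimsToZero⇒realisable : ∀ {S : Vec ℕ m} {C : Vec ℕ k} → TrimsToZero S C →
  Σ (Matrix m k) λ M → Realises M S C
trimsToZero⇒realisable {m} {S = S} t with trimSeq⇒matrix t
... | M , cs , split = M , Pointwise-≡⇒≡ (ext λ p → begin
  lookup (rowSums M) p                            ≡⟨ lookup∘tabulate _ p ⟩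
  count (row p M)                                 ≡⟨ +-identityʳ _ ⟨
  count (row p M) + 0                             ≡⟨ cong (count (row p M) +_) (lookup-replicate p 0) ⟨
  count (row p M) + lookup (replicate m 0) p      ≡⟨ split p ⟨
  lookup S p                                      ∎) , cs
  where open ≡-Reasoning

count-map-not+count : ∀ (v : Vec Bool k) → count (map not v) + count v ≡ k
count-map-not+count []          = refl
count-map-not+count (true  ∷ v) = trans (+-suc _ _) (cong suc (count-map-not+count v))
count-map-not+count (false ∷ v) = cong suc (count-map-not+count v)

count-map-not : ∀ (v : Vec Bool k) → count (map not v) ≡ k ∸ count v
count-map-not v = trans (sym (m+n∸n≡m _ (count v))) (cong (_∸ count v) (count-map-not+count v))

complementTranspose : Matrix m k → Matrix k m
complementTranspose M = tabulate λ p → map not (row p M)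

row-complementTranspose : ∀ (M : Matrix m k) j → row j (complementTranspose M) ≡ map not (lookup M j)
row-complementTranspose M j = Pointwise-≡⇒≡ (ext λ p → begin
  lookup (row j (complementTranspose M)) p         ≡⟨ lookup-map p _ (complementTranspose M) ⟩
  lookup (lookup (complementTranspose M) p) j      ≡⟨ cong (λ column → lookup column j) (lookup∘tabulate _ p) ⟩
  lookup (map not (row p M)) j                     ≡⟨ lookup-map j not (row p M) ⟩
  not (lookup (row p M) j)                         ≡⟨ cong not (lookup-map j _ M) ⟩
  not (lookup (lookup M j) p)                      ≡⟨ lookup-map p not (lookup M j) ⟨
  lookup (map not (lookup M j)) p                  ∎)
  where open ≡-Reasoning

rowSums-complementTranspose : ∀ (M : Matrix m k) → rowSums (complementTranspose M) ≡ compl m (colSums M)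
rowSums-complementTranspose {m} M = Pointwise-≡⇒≡ (ext λ j → begin
  lookup (rowSums (complementTranspose M)) j   ≡⟨ lookup∘tabulate _ j ⟩
  count (row j (complementTranspose M))        ≡⟨ cong count (row-complementTranspose M j) ⟩
  count (map not (lookup M j))                 ≡⟨ count-map-not (lookup M j) ⟩
  m ∸ count (lookup M j)                       ≡⟨ cong (m ∸_) (lookup-map j count M) ⟨
  m ∸ lookup (colSums M) j                     ≡⟨ lookup-map j (m ∸_) (colSums M) ⟨
  lookup (compl m (colSums M)) j               ∎)
  where open ≡-Reasoning

colSums-complementTranspose : ∀ (M : Matrix m k) → colSums (complementTranspose M) ≡ compl k (rowSums M)
colSums-complementTranspose {k = k} M = Pointwise-≡⇒≡ (ext λ p → begin
  lookup (colSums (complementTranspose M)) p   ≡⟨ lookup-map p count (complementTranspose M) ⟩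
  count (lookup (complementTranspose M) p)     ≡⟨ cong count (lookup∘tabulate _ p) ⟩
  count (map not (row p M))                    ≡⟨ count-map-not (row p M) ⟩
  k ∸ count (row p M)                          ≡⟨ cong (k ∸_) (lookup∘tabulate _ p) ⟨
  k ∸ lookup (rowSums M) p                     ≡⟨ lookup-map p (k ∸_) (rowSums M) ⟨
  lookup (compl k (rowSums M)) p               ∎)
  where open ≡-Reasoning

compl-involutive : ∀ {n} {A : Vec ℕ m} → IsSeq m n A → compl n (compl n A) ≡ A
compl-involutive []          = refl
compl-involutive (a≤n ∷ A≤n) = cong₂ _∷_ (m∸[m∸n]≡n a≤n) (compl-involutive A≤n)

trimsToZero-dual : ∀ {m n} {A : Vec ℕ m} {B : Vec ℕ n} → IsSeq m n A →
  TrimsToZero (compl n A) B → TrimsToZero (compl m B) A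
trimsToZero-dual {m} {n} A≤n t with trimsToZero⇒realisable t
... | M , rs , cs = realises⇒trimsToZero (complementTranspose M)
  ( trans (rowSums-complementTranspose M) (cong (compl m) cs)
  , trans (colSums-complementTranspose M) (trans (cong (compl n) rs) (compl-involutive A≤n)))

mainTheorem6 : (m n : ℕ) (A : Vec ℕ m) (B : Vec ℕ n) →
    Feasible m n A B →
    (TrimsToZero (compl n A) B ⇔ TrimsToZero (compl m B) A)
mainTheorem6 m n A B (A≤n , B≤m , _) = mk⇔ (trimsToZero-dual A≤n) (trimsToZero-dual B≤m)
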